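{- Let $a\geq 3$ and $m\geq 2a^2-a+2$ be integers, let $C(m,a)=\left\lceil\frac{m-1}{a}\left\lceil\frac{m-1}{a}\right\rceil\right\rceil$, and suppose the set $\{1,\ldots,C(m,a)\}$ is colored red and blue so that there is no monochromatic solution of $x_1+\cdots+x_{m-1}=ax_m$, with both $a-2$ and $a-1$ red. Then $2$ is red.
   Context: A solution is an assignment of values in $\{1,\ldots,C(m,a)\}$ to $x_1,\ldots,x_m$ (not necessarily distinct) making the equation true; it is monochromatic if all the values $x_1,\ldots,x_m$ have the same color. -}

module Defs where

open import Data.Nat using (ℕ; zero; suc; _+_; _*_; _∸_; _≤_; _/_)
open import Data.Nat.Properties using ()
open import Data.Fin using (Fin; inject₁; fromℕ)
import Data.Fin as F
open import Data.Empty using (⊥)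
open import Data.Product using (_×_; Σ)
open import Relation.Binary.PropositionalEquality using (_≡_)

data Color : Set where
  red blue : Color

⌈_/suc_⌉ : ℕ → ℕ → ℕ
⌈ n /suc k ⌉ = (n + k) / suc k

-- C(m,a) = ⌈ ((m-1)/a) ⌈ (m-1)/a ⌉ ⌉ = ⌈ (m-1)·⌈(m-1)/a⌉ / a ⌉, for a = suc k
C : ℕ → ℕ → ℕ
C m (suc k) = ⌈ (m ∸ 1) * ⌈ (m ∸ 1) /suc k ⌉ /suc k ⌉
C m zero = 0   -- unused (a ≥ 3 in all uses)

sumFin : (n : ℕ) → (Fin n → ℕ) → ℕ
sumFin zero f = 0
sumFin (suc n) f = f F.zero + sumFin n (λ i → f (F.suc i))

-- x : Fin (suc n) → ℕ are the variables x_1,…,x_m with m = suc n;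
-- x (fromℕ n) is x_m, x (inject₁ i) for i : Fin n are x_1,…,x_{m-1}.
IsSolution : (n a N : ℕ) → (Fin (suc n) → ℕ) → Set
IsSolution n a N x =
  ((i : Fin (suc n)) → (1 ≤ x i) × (x i ≤ N)) ×
  (sumFin n (λ i → x (inject₁ i)) ≡ a * x (fromℕ n))

Monochromatic : (n : ℕ) → (ℕ → Color) → (Fin (suc n) → ℕ) → Set
Monochromatic n col x = Σ Color (λ c → (i : Fin (suc n)) → col (x i) ≡ c)

NoMonoSolution : (n a N : ℕ) → (ℕ → Color) → Set
NoMonoSolution n a N col =
  (x : Fin (suc n) → ℕ) → IsSolution n a N x → Monochromatic n col x → ⊥

module Submission where

-- Write a = 4 + c (the case a = 3 is immediate, since then a - 1 = 2) and
-- n = m - 1, the number of summands.  The hypothesis on m gives a² ≤ n,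
-- so n = a(a-2) + q for some q, and n ≤ C(m,a).
--
-- 1. Solutions are built from lists: a list xs of length n and a value l
--    with sum xs = a·l, all of one colour and inside [1,N], would be a
--    monochromatic solution.
-- 2. Blue forcing: if n(a-2) ≤ a·y ≤ n(a-1) then y lies in [1,n] and is blue,
--    because a·y is a sum of n copies of the red numbers a-1 and a-2.
-- 3. Two blue numbers: t = ⌊n(a-1)/a⌋ and u = 2t - (n - (a-2)) both satisfy the
--    bounds of step 2 (this uses a ≥ 4 and a(a-2) ≤ n).
-- 4. If 2 were blue, then a-4 copies of t, two copies of u and n-(a-2) copies
--    of 2 sum to (a-4)t + 2·2t = a·t, a blue solution with x_m = t.

open import Defs
open import Data.Nat using (ℕ; zero; suc; _+_; _*_; _∸_; _≤_; z≤n; s≤s; _/_; _%_)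
open import Data.Nat.Properties
open import Data.Nat.DivMod using (m≡m%n+[m/n]*n; m%n<n; m*n/n≡m; /-monoˡ-≤)
open import Data.Nat.ListAction using (sum)
open import Data.Nat.ListAction.Properties using (sum-++)
open import Data.Nat.Tactic.RingSolver using (solve-∀)
open import Data.List using (List; []; _∷_; _++_; replicate; length)
open import Data.List.Properties using (length-++; length-replicate)
open import Data.List.Relation.Unary.All using (All; []; _∷_)
open import Data.List.Relation.Unary.All.Properties using (++⁺; replicate⁺)
open import Data.Fin using (Fin; inject₁; fromℕ)
import Data.Fin as F
open import Data.Product using (_×_; _,_; proj₁; proj₂)
open import Data.Empty using (⊥; ⊥-elim)
open import Relation.Binary.PropositionalEquality

assignment : (xs : List ℕ) → ℕ → Fin (suc (length xs)) → ℕ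
assignment []       l F.zero    = l
assignment (x ∷ xs) l F.zero    = x
assignment (x ∷ xs) l (F.suc i) = assignment xs l i

assignment-lhs : ∀ xs l → sumFin (length xs) (λ i → assignment xs l (inject₁ i)) ≡ sum xs
assignment-lhs []       l = refl
assignment-lhs (x ∷ xs) l = cong (x +_) (assignment-lhs xs l)

assignment-last : ∀ xs l → assignment xs l (fromℕ (length xs)) ≡ l
assignment-last []       l = refl
assignment-last (x ∷ xs) l = assignment-last xs l

assignment-all : ∀ {P : ℕ → Set} xs l → All P xs → P l → ∀ i → P (assignment xs l i)
assignment-all []       l []         pl F.zero    = pl
assignment-all (x ∷ xs) l (px ∷ pxs) pl F.zero    = px
assignment-all (x ∷ xs) l (px ∷ pxs) pl (F.suc i) = assignment-all xs l pxs pl i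

InClass : ℕ → (ℕ → Color) → Color → ℕ → Set
InClass N col colour v = (1 ≤ v × v ≤ N) × col v ≡ colour

noMonoList : ∀ {n a N col colour} (xs : List ℕ) (l : ℕ) → length xs ≡ n →
             NoMonoSolution n a N col → sum xs ≡ a * l →
             All (InClass N col colour) xs → InClass N col colour l → ⊥
noMonoList {a = a} {N = N} {col = col} {colour = colour} xs l refl noMono sum≡ inXs inL =
  noMono (assignment xs l) ((λ i → proj₁ (inAll i)) , equation) (colour , λ i → proj₂ (inAll i))
  where
  inAll : ∀ i → InClass N col colour (assignment xs l i)
  inAll = assignment-all xs l inXs inL
  equation : sumFin (length xs) (λ i → assignment xs l (inject₁ i)) ≡ a * assignment xs l (fromℕ (length xs))
  equation = trans (assignment-lhs xs l) (trans sum≡ (cong (a *_) (sym (assignment-last xs l))))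

sum-replicate : ∀ k v → sum (replicate k v) ≡ k * v
sum-replicate zero    v = refl
sum-replicate (suc k) v = cong (v +_) (sum-replicate k v)

m≤m*m : ∀ m → m ≤ m * m
m≤m*m zero    = z≤n
m≤m*m (suc m) = m≤m*n (suc m) (suc m)

double-square : ∀ a → a * a + a * a ≡ 2 * a * a
double-square = solve-∀

square≤ : ∀ a n → 2 * a * a ∸ a + 2 ≤ suc n → a * a ≤ n
square≤ a n h = ≤-trans (m+n≤o⇒m≤o∸n (a * a) aa+a≤2aa) (≤-pred (<-≤-trans (m<m+n _ (s≤s z≤n)) h))
  where
  aa+a≤2aa : a * a + a ≤ 2 * a * a
  aa+a≤2aa = ≤-trans (+-monoʳ-≤ (a * a) (m≤m*m a)) (≤-reflexive (double-square a))

-- If a² ≤ n then C(n+1, a) ≥ n, so [1,n] is part of the coloured range.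
n≤C : ∀ k n → suc k * suc k ≤ n → n ≤ C (suc n) (suc k)
n≤C k n big = ≤-trans (≤-reflexive (sym (m*n/n≡m n (suc k))))
                (/-monoˡ-≤ (suc k) (≤-trans (*-monoʳ-≤ n a≤⌈n/a⌉) (m≤m+n _ k)))
  where
  a≤⌈n/a⌉ : suc k ≤ (n + k) / suc k
  a≤⌈n/a⌉ = ≤-trans (≤-reflexive (sym (m*n/n≡m (suc k) (suc k))))
              (/-monoˡ-≤ (suc k) (≤-trans big (m≤m+n n k)))

-- Polynomial identities used below, with a = 4 + c, n = a(a-2) + q and
-- p = n - (a-2) = (a-1)(a-2) + q written out.
repr-identity : ∀ c s m → s * (3 + c) + m * (2 + c) ≡ (s + m) * (2 + c) + s
repr-identity = solve-∀

twice-identity : ∀ c q → 2 * (((4 + c) * (2 + c) + q) * (3 + c))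
               ≡ ((4 + c) * (2 + c) + q) * (2 + c) + ((4 + c) * ((3 + c) * (2 + c) + q) + (4 + c) * (2 + c))
twice-identity = solve-∀

ap-identity : ∀ c q → (4 + c) * ((3 + c) * (2 + c) + q) ≡ ((4 + c) * (2 + c) + q) * (3 + c) + q
ap-identity = solve-∀

count-identity : ∀ c q → c + (2 + ((3 + c) * (2 + c) + q)) ≡ (4 + c) * (2 + c) + q
count-identity = solve-∀

doubling-identity : ∀ a t r → 2 * (r + t * a) ≡ a * (2 * t) + 2 * r
doubling-identity = solve-∀

regroup-identity : ∀ a u p r → a * u + (a * p + 2 * r) ≡ a * (p + u) + 2 * r
regroup-identity = solve-∀

blue-sum-identity : ∀ c t u p → c * t + (u + (u + p * 2)) ≡ c * t + 2 * (p + u)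
blue-sum-identity = solve-∀

final-sum-identity : ∀ c t → c * t + 2 * (2 * t) ≡ (4 + c) * t
final-sum-identity = solve-∀

module BlueForcing (c q N : ℕ) (col : ℕ → Color)
       (noMono : NoMonoSolution ((4 + c) * (2 + c) + q) (4 + c) N col)
       (red₁ : col (3 + c) ≡ red) (red₂ : col (2 + c) ≡ red)
       (n≤N : (4 + c) * (2 + c) + q ≤ N) where

  a n p : ℕ
  a = 4 + c
  n = a * (2 + c) + q
  p = (3 + c) * (2 + c) + q

  Class : Color → ℕ → Set
  Class = InClass N col

  refute : ∀ {colour} (xs : List ℕ) (l : ℕ) → length xs ≡ n → sum xs ≡ a * l →
           All (Class colour) xs → Class colour l → ⊥
  refute xs l length≡ = noMonoList {a = a} {col = col} xs l length≡ noMono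

  -- Since a ≤ n ≤ N, the numbers 2, a-2, a-1 and all of [1,n] are coloured.
  a≤n : a ≤ n
  a≤n = ≤-trans (m≤m*n a (2 + c)) (m≤m+n _ q)

  inRange : ∀ {v} → 1 ≤ v → v ≤ n → 1 ≤ v × v ≤ N
  inRange 1≤v v≤n = 1≤v , ≤-trans v≤n n≤N

  red₁∈ : Class red (3 + c)
  red₁∈ = inRange (s≤s z≤n) (≤-trans (n≤1+n _) a≤n) , red₁

  red₂∈ : Class red (2 + c)
  red₂∈ = inRange (s≤s z≤n) (≤-trans (≤-trans (n≤1+n _) (n≤1+n _)) a≤n) , red₂

  Between : ℕ → Set
  Between y = n * (2 + c) ≤ a * y × a * y ≤ n * (3 + c)

  between⇒range : ∀ {y} → Between y → 1 ≤ y × y ≤ N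
  between⇒range {zero} (low , _) = ⊥-elim (1≰0 (≤-trans lowerBound>0 (≤-trans low (≤-reflexive (*-zeroʳ a)))))
    where
    lowerBound>0 : 1 ≤ n * (2 + c)
    lowerBound>0 = ≤-trans (≤-trans (s≤s z≤n) a≤n) (m≤m*n n (2 + c))
    1≰0 : 1 ≤ 0 → ⊥
    1≰0 ()
  between⇒range {y@(suc _)} (_ , high) = inRange (s≤s z≤n) (*-cancelˡ-≤ a ay≤an)
    where
    ay≤an : a * y ≤ a * n
    ay≤an = ≤-trans high (≤-trans (*-monoʳ-≤ n (n≤1+n (3 + c))) (≤-reflexive (*-comm n a)))

  -- Step 2: a·y = s(a-1) + (n-s)(a-2) with s = a·y - n(a-2) ≤ n, so y cannot be red.
  forcedBlue : ∀ {y} → Between y → Class blue y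
  forcedBlue {y} between@(low , high) with col y in colY
  ... | blue = between⇒range between , refl
  ... | red  = ⊥-elim (refute xs y length≡ sum≡
                 (++⁺ (replicate⁺ s red₁∈) (replicate⁺ (n ∸ s) red₂∈))
                 (between⇒range between , colY))
    where
    s : ℕ
    s = a * y ∸ n * (2 + c)
    s≤n : s ≤ n
    s≤n = ≤-trans (∸-monoˡ-≤ (n * (2 + c)) high)
            (≤-reflexive (trans (cong (_∸ n * (2 + c)) (*-suc n (2 + c))) (m+n∸n≡m n (n * (2 + c)))))
    xs : List ℕ
    xs = replicate s (3 + c) ++ replicate (n ∸ s) (2 + c)
    length≡ : length xs ≡ n
    length≡ = trans (length-++ (replicate s (3 + c)))
                (trans (cong₂ _+_ (length-replicate s) (length-replicate (n ∸ s))) (m+[n∸m]≡n s≤n))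
    sum≡ : sum xs ≡ a * y
    sum≡ = begin
      sum xs                                     ≡⟨ sum-++ (replicate s (3 + c)) _ ⟩
      sum (replicate s (3 + c)) + sum (replicate (n ∸ s) (2 + c))
        ≡⟨ cong₂ _+_ (sum-replicate s (3 + c)) (sum-replicate (n ∸ s) (2 + c)) ⟩
      s * (3 + c) + (n ∸ s) * (2 + c)             ≡⟨ repr-identity c s (n ∸ s) ⟩
      (s + (n ∸ s)) * (2 + c) + s                 ≡⟨ cong (λ k → k * (2 + c) + s) (m+[n∸m]≡n s≤n) ⟩
      n * (2 + c) + s                             ≡⟨ m+[n∸m]≡n low ⟩
      a * y                                       ∎
      where open ≡-Reasoning

  t r : ℕ
  t = n * (3 + c) / a
  r = n * (3 + c) % a

  division : n * (3 + c) ≡ r + t * a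
  division = m≡m%n+[m/n]*n (n * (3 + c)) a

  r≤a-1 : r ≤ 3 + c
  r≤a-1 = ≤-pred (m%n<n (n * (3 + c)) a)

  -- n(a-1) - a < a·t ≤ n(a-1), and n(a-1) - a ≥ n(a-2) since n ≥ a.
  t-between : Between t
  t-between = low , high
    where
    open ≤-Reasoning
    low : n * (2 + c) ≤ a * t
    low = +-cancelʳ-≤ r _ _ (begin
      n * (2 + c) + r ≤⟨ +-monoʳ-≤ (n * (2 + c)) (≤-trans r≤a-1 (≤-trans (n≤1+n (3 + c)) a≤n)) ⟩
      n * (2 + c) + n ≡⟨ +-comm (n * (2 + c)) n ⟩
      n + n * (2 + c) ≡⟨ *-suc n (2 + c) ⟨
      n * (3 + c)     ≡⟨ division ⟩
      r + t * a       ≡⟨ +-comm r (t * a) ⟩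
      t * a + r       ≡⟨ cong (_+ r) (*-comm t a) ⟩
      a * t + r       ∎)
    high : a * t ≤ n * (3 + c)
    high = begin
      a * t     ≡⟨ *-comm a t ⟩
      t * a     ≤⟨ m≤n+m (t * a) r ⟩
      r + t * a ≡⟨ division ⟨
      n * (3 + c) ∎

  doubling : 2 * (n * (3 + c)) ≡ a * (2 * t) + 2 * r
  doubling = trans (cong (2 *_) division) (doubling-identity a t r)

  -- n(a-2) + a·p + 2r ≤ 2n(a-1), using n·a = a·p + a(a-2) and
  -- 2r ≤ 2(a-1) ≤ a(a-2), which holds as a ≥ 4.
  key : n * (2 + c) + (a * p + 2 * r) ≤ 2 * (n * (3 + c))
  key = begin
    n * (2 + c) + (a * p + 2 * r)       ≤⟨ +-monoʳ-≤ (n * (2 + c)) (+-monoʳ-≤ (a * p) 2r≤slack) ⟩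
    n * (2 + c) + (a * p + a * (2 + c)) ≡⟨ twice-identity c q ⟨
    2 * (n * (3 + c))                   ∎
    where
    open ≤-Reasoning
    2r≤slack : 2 * r ≤ a * (2 + c)
    2r≤slack = ≤-trans (*-monoʳ-≤ 2 r≤a-1)
                  (≤-trans (*-mono-≤ (m≤m+n 2 c) (n≤1+n (3 + c))) (≤-reflexive (*-comm (2 + c) a)))

  -- Hence a·p ≤ 2a·t, so u = 2t - p is a genuine natural number.
  p≤2t : p ≤ 2 * t
  p≤2t = *-cancelˡ-≤ a (+-cancelʳ-≤ (2 * r) _ _
           (≤-trans (m≤n+m (a * p + 2 * r) (n * (2 + c))) (≤-trans key (≤-reflexive doubling))))

  u : ℕ
  u = 2 * t ∸ p

  p+u≡2t : p + u ≡ 2 * t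
  p+u≡2t = m+[n∸m]≡n p≤2t

  u-equation : a * u + (a * p + 2 * r) ≡ 2 * (n * (3 + c))
  u-equation = trans (regroup-identity a u p r) (trans (cong (λ k → a * k + 2 * r) p+u≡2t) (sym doubling))

  -- a·u = n(a-2) + (a(a-2) - 2r), which is at most n(a-1) because a(a-2) ≤ n.
  u-between : Between u
  u-between = low , high
    where
    open ≤-Reasoning
    low : n * (2 + c) ≤ a * u
    low = +-cancelʳ-≤ (a * p + 2 * r) _ _ (≤-trans key (≤-reflexive (sym u-equation)))
    high : a * u ≤ n * (3 + c)
    high = +-cancelʳ-≤ (a * p + 2 * r) _ _ (begin
      a * u + (a * p + 2 * r)       ≡⟨ u-equation ⟩
      n * (3 + c) + (n * (3 + c) + 0) ≡⟨ cong (n * (3 + c) +_) (+-identityʳ (n * (3 + c))) ⟩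
      n * (3 + c) + n * (3 + c)     ≤⟨ +-monoʳ-≤ (n * (3 + c)) (≤-trans (m≤m+n (n * (3 + c)) q) (≤-reflexive (sym (ap-identity c q)))) ⟩
      n * (3 + c) + a * p           ≤⟨ +-monoʳ-≤ (n * (3 + c)) (m≤m+n (a * p) (2 * r)) ⟩
      n * (3 + c) + (a * p + 2 * r) ∎)

  -- Step 4: with 2 blue, (a-4)·t + 2u + p·2 = a·t is a blue solution.
  twoIsRed : col 2 ≡ red
  twoIsRed with col 2 in col2
  ... | red  = refl
  ... | blue = ⊥-elim (refute xs t length≡ sum≡
                 (++⁺ (replicate⁺ c t∈) (u∈ ∷ u∈ ∷ replicate⁺ p two∈)) t∈)
    where
    t∈ : Class blue t
    t∈ = forcedBlue t-between
    u∈ : Class blue u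
    u∈ = forcedBlue u-between
    two∈ : Class blue 2
    two∈ = inRange (s≤s z≤n) (≤-trans (s≤s (s≤s z≤n)) a≤n) , col2
    xs : List ℕ
    xs = replicate c t ++ u ∷ u ∷ replicate p 2
    length≡ : length xs ≡ n
    length≡ = trans (length-++ (replicate c t))
                (trans (cong₂ (λ i j → i + (2 + j)) (length-replicate c) (length-replicate p)) (count-identity c q))
    sum≡ : sum xs ≡ a * t
    sum≡ = begin
      sum xs                                              ≡⟨ sum-++ (replicate c t) _ ⟩
      sum (replicate c t) + (u + (u + sum (replicate p 2)))
        ≡⟨ cong₂ (λ i j → i + (u + (u + j))) (sum-replicate c t) (sum-replicate p 2) ⟩
      c * t + (u + (u + p * 2))                           ≡⟨ blue-sum-identity c t u p ⟩
      c * t + 2 * (p + u)                                 ≡⟨ cong (λ k → c * t + 2 * k) p+u≡2t ⟩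
      c * t + 2 * (2 * t)                                 ≡⟨ final-sum-identity c t ⟩
      a * t                                               ∎
      where open ≡-Reasoning

twoIsRed : ∀ c n N (col : ℕ → Color) → (4 + c) * (4 + c) ≤ n → n ≤ N →
           NoMonoSolution n (4 + c) N col → col (3 + c) ≡ red → col (2 + c) ≡ red →
           col 2 ≡ red
twoIsRed c n N col a²≤n n≤N noMono red₁ red₂
  with q , refl ← m≤n⇒∃[o]m+o≡n (≤-trans (*-monoʳ-≤ (4 + c) (m≤n+m (2 + c) 2)) a²≤n)
  = BlueForcing.twoIsRed c q N col noMono red₁ red₂ n≤N

-- For a = 3 the hypothesis col (a - 1) ≡ red is the claim itself; for
-- a ≥ 4 the hypothesis on m gives a² ≤ n ≤ C(m,a).
lemma6 : (a n : ℕ) → 3 ≤ a → 2 * a * a ∸ a + 2 ≤ suc n →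
         (col : ℕ → Color) →
         NoMonoSolution n a (C (suc n) a) col →
         col (a ∸ 2) ≡ red → col (a ∸ 1) ≡ red →
         col 2 ≡ red
lemma6 1 n (s≤s ()) _ col _ _ _
lemma6 2 n (s≤s (s≤s ())) _ col _ _ _
lemma6 3 n _ _ col _ _ red₁ = red₁
lemma6 a@(suc (suc (suc (suc c)))) n _ h col noMono red₂ red₁ =
  twoIsRed c n (C (suc n) a) col a²≤n (n≤C (3 + c) n a²≤n) noMono red₁ red₂
  where
  a²≤n : a * a ≤ n
  a²≤n = square≤ a n h
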